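{- Let $A,B,C\in\mathbb{Z}$ and let $F$ be one of the forms $Ax^4+Bx^2y^2+Cy^4$, $Ax^4+Bx^3y+(C+2A)x^2y^2+Bxy^3+Ay^4$, or $Ax^4+Bx^3y+(C-2A)x^2y^2-Bxy^3+Ay^4$. If $Q_F$ is maximal, then $B^2-4AC$ is a fundamental discriminant.
   Context: For an integral binary quartic form $F=a_4x^4+a_3x^3y+a_2x^2y^2+a_1xy^3+a_0y^4$, $Q_F$ is the quartic ring associated to $F$ by Birch–Merriman/Nakagawa (equivalently, by Wood, the quartic ring corresponding under Bhargava's parametrization to $(U_0,V_F)$ with $U_0=-xy+z^2$, $V_F=a_0x^2+a_4y^2+a_2z^2+a_1xz+a_3yz$); when $F$ is irreducible and $\theta$ is a root of $F(x,1)$, $Q_F=\mathbb{Z}\oplus\mathbb{Z}a_4\theta\oplus\mathbb{Z}(a_4\theta^2+a_3\theta)\oplus\mathbb{Z}(a_4\theta^3+a_3\theta^2+a_2\theta)$. $Q_F$ is maximal if $\mathbb{Z}_p\otimes Q_F$ is a maximal quartic $\mathbb{Z}_p$-ring for every prime $p$. -}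

module Defs where

open import Data.Nat as ℕ using (ℕ)
open import Data.Nat.Divisibility using (_∣_)
open import Data.Integer using (ℤ; +_; _+_; _*_; -_; _-_; ∣_∣)
open import Data.Fin using (Fin; zero; suc)
open import Data.List using (List; foldr; map; allFin; concatMap)
open import Data.Product using (Σ; _×_; _,_)
open import Data.Sum using (_⊎_)
open import Relation.Nullary using (¬_)
open import Relation.Binary.PropositionalEquality using (_≡_)

-- Integral binary quartic forms
--   F = a4 x^4 + a3 x^3 y + a2 x^2 y^2 + a1 x y^3 + a0 y^4

record BQF : Set where
  constructor bqf
  field
    a4 a3 a2 a1 a0 : ℤ

-- Elements of ℤ^4, written in the basis
--   ζ0 = 1, ζ1 = a4 θ, ζ2 = a4 θ² + a3 θ, ζ3 = a4 θ³ + a3 θ² + a2 θ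
-- of the quartic ring Q_F.

record Q4 : Set where
  constructor ⟨_,_,_,_⟩
  field
    c0 c1 c2 c3 : ℤ

infixl 6 _⊕_
infixl 7 _⊙_

_⊕_ : Q4 → Q4 → Q4
⟨ a , b , c , d ⟩ ⊕ ⟨ a' , b' , c' , d' ⟩ = ⟨ a + a' , b + b' , c + c' , d + d' ⟩

_⊙_ : ℤ → Q4 → Q4
k ⊙ ⟨ a , b , c , d ⟩ = ⟨ k * a , k * b , k * c , k * d ⟩

neg : Q4 → Q4
neg x = (- + 1) ⊙ x

zeroQ : Q4
zeroQ = ⟨ + 0 , + 0 , + 0 , + 0 ⟩

coord : Q4 → Fin 4 → ℤ
coord ⟨ a , b , c , d ⟩ zero = a
coord ⟨ a , b , c , d ⟩ (suc zero) = b
coord ⟨ a , b , c , d ⟩ (suc (suc zero)) = c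
coord ⟨ a , b , c , d ⟩ (suc (suc (suc zero))) = d

-- Multiplication table of Q_F (Birch–Merriman / Nakagawa ring):
--   ζ1ζ1 = -a3 ζ1 + a4 ζ2
--   ζ1ζ2 = -a2 ζ1 + a4 ζ3
--   ζ1ζ3 = -a0 a4 - a1 ζ1
--   ζ2ζ2 = -a0 a4 - a1 ζ1 - a2 ζ2 + a3 ζ3
--   ζ2ζ3 = -a0 a3 - a0 ζ1 - a1 ζ2
--   ζ3ζ3 = -a0 a2 - a0 ζ2 - a1 ζ3
-- (derived from the relation a4θ⁴+a3θ³+a2θ²+a1θ+a0 = 0; these are
-- polynomial identities, valid for every F, reducible or not).
basisProd : BQF → Fin 4 → Fin 4 → Q4
basisProd F zero zero = ⟨ + 1 , + 0 , + 0 , + 0 ⟩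
basisProd F zero (suc zero) = ⟨ + 0 , + 1 , + 0 , + 0 ⟩
basisProd F zero (suc (suc zero)) = ⟨ + 0 , + 0 , + 1 , + 0 ⟩
basisProd F zero (suc (suc (suc zero))) = ⟨ + 0 , + 0 , + 0 , + 1 ⟩
basisProd F (suc zero) zero = ⟨ + 0 , + 1 , + 0 , + 0 ⟩
basisProd F (suc (suc zero)) zero = ⟨ + 0 , + 0 , + 1 , + 0 ⟩
basisProd F (suc (suc (suc zero))) zero = ⟨ + 0 , + 0 , + 0 , + 1 ⟩
basisProd (bqf a4 a3 a2 a1 a0) (suc zero) (suc zero) =
  ⟨ + 0 , - a3 , a4 , + 0 ⟩
basisProd (bqf a4 a3 a2 a1 a0) (suc zero) (suc (suc zero)) =
  ⟨ + 0 , - a2 , + 0 , a4 ⟩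
basisProd (bqf a4 a3 a2 a1 a0) (suc zero) (suc (suc (suc zero))) =
  ⟨ - (a0 * a4) , - a1 , + 0 , + 0 ⟩
basisProd (bqf a4 a3 a2 a1 a0) (suc (suc zero)) (suc zero) =
  ⟨ + 0 , - a2 , + 0 , a4 ⟩
basisProd (bqf a4 a3 a2 a1 a0) (suc (suc zero)) (suc (suc zero)) =
  ⟨ - (a0 * a4) , - a1 , - a2 , a3 ⟩
basisProd (bqf a4 a3 a2 a1 a0) (suc (suc zero)) (suc (suc (suc zero))) =
  ⟨ - (a0 * a3) , - a0 , - a1 , + 0 ⟩
basisProd (bqf a4 a3 a2 a1 a0) (suc (suc (suc zero))) (suc zero) =
  ⟨ - (a0 * a4) , - a1 , + 0 , + 0 ⟩
basisProd (bqf a4 a3 a2 a1 a0) (suc (suc (suc zero))) (suc (suc zero)) =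
  ⟨ - (a0 * a3) , - a0 , - a1 , + 0 ⟩
basisProd (bqf a4 a3 a2 a1 a0) (suc (suc (suc zero))) (suc (suc (suc zero))) =
  ⟨ - (a0 * a2) , + 0 , - a0 , - a1 ⟩

sumQ : List Q4 → Q4
sumQ = foldr _⊕_ zeroQ

mulQ : BQF → Q4 → Q4 → Q4
mulQ F x y =
  sumQ (concatMap (λ i → map (λ j → (coord x i * coord y j) ⊙ basisProd F i j)
                               (allFin 4))
                  (allFin 4))

-- An order strictly containing Q_F inside Q_F ⊗ ℚ = ℚ^4 is given by a
-- denominator d ≥ 1 and the set S = { x / d : P x } ⊆ (1/d) Q_F such that
--   * Q_F ⊆ S                       (P (d x) for every x ∈ ℤ^4)
--   * S is an additive subgroup
--   * S is closed under multiplication: (x/d)(y/d) = z/d with z ∈ P,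
--     i.e. x·y = d z
--   * S ≠ Q_F.
-- (Every order containing Q_F has finite index, hence lies in (1/d)Q_F for
-- some d, so this describes all proper over-orders.)

record ProperOverring (F : BQF) : Set₁ where
  field
    d       : ℕ
    d≥1     : 1 ℕ.≤ d
    P       : Q4 → Set
    P-Q     : ∀ x → P ((+ d) ⊙ x)
    P-add   : ∀ {x y} → P x → P y → P (x ⊕ y)
    P-neg   : ∀ {x} → P x → P (neg x)
    P-mul   : ∀ {x y} → P x → P y →
              Σ Q4 (λ z → (mulQ F x y ≡ (+ d) ⊙ z) × P z)
    strict  : Σ Q4 (λ x → P x × ¬ (Σ Q4 (λ y → x ≡ (+ d) ⊙ y)))

Maximal : BQF → Set₁
Maximal F = ¬ ProperOverring F

SquarefreeZ : ℤ → Set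
SquarefreeZ m = ∀ (n : ℕ) → (n ℕ.* n) ∣ ∣ m ∣ → n ≡ 1

FundamentalDisc : ℤ → Set
FundamentalDisc D =
  (Σ ℤ (λ k → D ≡ + 1 + + 4 * k) × SquarefreeZ D)
  ⊎ Σ ℤ (λ m → D ≡ + 4 * m
               × (Σ ℤ (λ k → m ≡ + 2 + + 4 * k) ⊎ Σ ℤ (λ k → m ≡ + 3 + + 4 * k))
               × SquarefreeZ m)

form₁ : ℤ → ℤ → ℤ → BQF
form₁ A B C = bqf A (+ 0) B (+ 0) C

form₂ : ℤ → ℤ → ℤ → BQF
form₂ A B C = bqf A B (C + + 2 * A) B A

form₃ : ℤ → ℤ → ℤ → BQF
form₃ A B C = bqf A B (C - + 2 * A) (- B) A

-- In each of the three families Q_F contains an element ω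
-- with ω² + Bω + AC = 0 (namely ζ₂, ζ₁ − ζ₃ − B and ζ₁ + ζ₃ − B) such that
-- 1, ω extend to a ℤ-basis of Q_F.  If D = B² − 4AC is not a fundamental
-- discriminant, the order ℤ[ω] of discriminant D is not maximal: for some
-- n, s, c with n ∤ c, the element (s + cω)/n has integral trace
-- (2s − cB)/n and norm (s² − cBs + c²AC)/n².  Then β = s + cω satisfies
-- β² ∈ nℤβ + n²ℤ and β ∉ nQ_F, so Q_F + (β/n)Q_F is an order strictly
-- containing Q_F.  The triple (n, s, c) comes from a case analysis on D:
-- for odd B a square factor n² of D has n ≥ 3 and gives (n, B, 2); for
-- B = 2b and m = b² − AC, take (2, b, 1) if 4 ∣ m, (2, b + 1, 1) if
-- m ≡ 1 (mod 4), and (n, b, 1) for a square factor n² of m otherwise.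

module Submission where

open import Defs
open import Data.Integer using (ℤ; +_; _*_; _-_)
open import Data.Sum using (_⊎_)
open import Relation.Binary.PropositionalEquality using (_≡_)

open import Algebra using (CommutativeRing; CommutativeSemiring)
open import Algebra.Consequences.Propositional {A = Q4} using (comm∧idˡ⇒id; comm∧invˡ⇒inv; comm∧distrˡ⇒distrʳ)
open import Algebra.Definitions {A = Q4} _≡_ using (Associative; Commutative; LeftIdentity; LeftInverse; _DistributesOverˡ_)
import Algebra.Properties.Ring as RingProperties
open import Algebra.Structures {A = Q4} _≡_ using (IsCommutativeRing)
open import Data.Empty using (⊥-elim)
open import Data.Fin using (Fin; zero; suc; toℕ; fromℕ<)
open import Data.Fin.Properties using (toℕ-fromℕ<)
open import Data.Integer using (_+_; -_; ∣_∣)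
open import Data.Integer.DivMod using (_/ℕ_; _%ℕ_; n%ℕd<d; a≡a%ℕn+[a/ℕn]*n)
open import Data.Integer.Divisibility.Signed using (_∣_; divides; ∣ᵤ⇒∣; ∣⇒∣ᵤ; ∣m⇒∣-m; ∣m+n∣n⇒∣m)
open import Data.Integer.Properties
  using (+-assoc; +-comm; +-identityˡ; +-inverseˡ; -1*i≡-i; abs-*; *-assoc; *-comm; neg-distribʳ-*)
open import Data.Integer.Tactic.RingSolver using () renaming (solve to ℤ-solve)
open import Data.List using (List; []; _∷_)
open import Data.Nat as ℕ using (ℕ; suc; z≤n; s≤s)
import Data.Nat.Divisibility as ℕ
import Data.Nat.Properties as ℕ
open import Data.Product using (Σ; _×_; _,_)
open import Data.Sum using (inj₁; inj₂; [_,_]′)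
open import Function using (id)
open import Level using (0ℓ)
open import Relation.Nullary using (¬_; yes; no; contradiction)
open import Relation.Nullary.Decidable using (_×-dec_)
open import Relation.Binary.PropositionalEquality
  using (refl; sym; trans; cong; cong₂; subst; isEquivalence; module ≡-Reasoning)

Q4-cong : ∀ {a b c d a′ b′ c′ d′ : ℤ} → a ≡ a′ → b ≡ b′ → c ≡ c′ → d ≡ d′ →
          ⟨ a , b , c , d ⟩ ≡ ⟨ a′ , b′ , c′ , d′ ⟩
Q4-cong refl refl refl refl = refl

oneQ : Q4
oneQ = ⟨ + 1 , + 0 , + 0 , + 0 ⟩

embed : ℤ → Q4
embed k = ⟨ k , + 0 , + 0 , + 0 ⟩

⊕-assoc : Associative _⊕_
⊕-assoc ⟨ x0 , x1 , x2 , x3 ⟩ ⟨ y0 , y1 , y2 , y3 ⟩ ⟨ z0 , z1 , z2 , z3 ⟩ =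
  Q4-cong (+-assoc x0 y0 z0) (+-assoc x1 y1 z1) (+-assoc x2 y2 z2) (+-assoc x3 y3 z3)

⊕-comm : Commutative _⊕_
⊕-comm ⟨ x0 , x1 , x2 , x3 ⟩ ⟨ y0 , y1 , y2 , y3 ⟩ =
  Q4-cong (+-comm x0 y0) (+-comm x1 y1) (+-comm x2 y2) (+-comm x3 y3)

⊕-identityˡ : LeftIdentity zeroQ _⊕_
⊕-identityˡ ⟨ x0 , x1 , x2 , x3 ⟩ = Q4-cong (+-identityˡ x0) (+-identityˡ x1) (+-identityˡ x2) (+-identityˡ x3)

neg-inverseˡ : LeftInverse zeroQ neg _⊕_
neg-inverseˡ ⟨ x0 , x1 , x2 , x3 ⟩ = Q4-cong (inverse x0) (inverse x1) (inverse x2) (inverse x3)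
  where
  inverse : ∀ i → - + 1 * i + i ≡ + 0
  inverse i = trans (cong (_+ i) (-1*i≡-i i)) (+-inverseˡ i)

-- The multiplication table of Defs, expanded bilinearly.  It is opaque so
-- that equations between products are compared as terms, without
-- unfolding them into coordinates.
opaque
  mul : BQF → Q4 → Q4 → Q4
  mul (bqf a4 a3 a2 a1 a0) ⟨ x0 , x1 , x2 , x3 ⟩ ⟨ y0 , y1 , y2 , y3 ⟩ =
    ⟨ x0 * y0 - a0 * a4 * (x1 * y3 + x3 * y1 + x2 * y2) - a0 * a3 * (x2 * y3 + x3 * y2) - a0 * a2 * (x3 * y3)
    , x0 * y1 + x1 * y0 - a3 * (x1 * y1) - a2 * (x1 * y2 + x2 * y1) - a1 * (x1 * y3 + x3 * y1 + x2 * y2) - a0 * (x2 * y3 + x3 * y2)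
    , x0 * y2 + x2 * y0 + a4 * (x1 * y1) - a2 * (x2 * y2) - a1 * (x2 * y3 + x3 * y2) - a0 * (x3 * y3)
    , x0 * y3 + x3 * y0 + a4 * (x1 * y2 + x2 * y1) + a3 * (x2 * y2) - a1 * (x3 * y3)
    ⟩

-- The identities below are checked coordinatewise by the ring solver for ℤ,
-- which only sees through a product whose arguments are explicit tuples;
-- the ≡⟨⟩ steps put the goals into that shape.
opaque
  unfolding mul

  mulQ≡mul : ∀ F x y → mulQ F x y ≡ mul F x y
  mulQ≡mul (bqf a4 a3 a2 a1 a0) ⟨ x0 , x1 , x2 , x3 ⟩ ⟨ y0 , y1 , y2 , y3 ⟩ = begin
    mulQ (bqf a4 a3 a2 a1 a0) ⟨ x0 , x1 , x2 , x3 ⟩ ⟨ y0 , y1 , y2 , y3 ⟩ ≡⟨⟩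
    ⟨ ((x0 * y0) * (+ 1) + ((x0 * y1) * (+ 0) + ((x0 * y2) * (+ 0) + ((x0 * y3) * (+ 0) +
      ((x1 * y0) * (+ 0) + ((x1 * y1) * (+ 0) + ((x1 * y2) * (+ 0) + ((x1 * y3) * (- (a0 * a4)) +
      ((x2 * y0) * (+ 0) + ((x2 * y1) * (+ 0) + ((x2 * y2) * (- (a0 * a4)) + ((x2 * y3) * (- (a0 * a3)) +
      ((x3 * y0) * (+ 0) + ((x3 * y1) * (- (a0 * a4)) + ((x3 * y2) * (- (a0 * a3)) + ((x3 * y3) * (- (a0 * a2)) + (+ 0)))))))))))))))))
    , ((x0 * y0) * (+ 0) + ((x0 * y1) * (+ 1) + ((x0 * y2) * (+ 0) + ((x0 * y3) * (+ 0) +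
      ((x1 * y0) * (+ 1) + ((x1 * y1) * (- a3) + ((x1 * y2) * (- a2) + ((x1 * y3) * (- a1) +
      ((x2 * y0) * (+ 0) + ((x2 * y1) * (- a2) + ((x2 * y2) * (- a1) + ((x2 * y3) * (- a0) +
      ((x3 * y0) * (+ 0) + ((x3 * y1) * (- a1) + ((x3 * y2) * (- a0) + ((x3 * y3) * (+ 0) + (+ 0)))))))))))))))))
    , ((x0 * y0) * (+ 0) + ((x0 * y1) * (+ 0) + ((x0 * y2) * (+ 1) + ((x0 * y3) * (+ 0) +
      ((x1 * y0) * (+ 0) + ((x1 * y1) * (a4) + ((x1 * y2) * (+ 0) + ((x1 * y3) * (+ 0) +
      ((x2 * y0) * (+ 1) + ((x2 * y1) * (+ 0) + ((x2 * y2) * (- a2) + ((x2 * y3) * (- a1) +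
      ((x3 * y0) * (+ 0) + ((x3 * y1) * (+ 0) + ((x3 * y2) * (- a1) + ((x3 * y3) * (- a0) + (+ 0)))))))))))))))))
    , ((x0 * y0) * (+ 0) + ((x0 * y1) * (+ 0) + ((x0 * y2) * (+ 0) + ((x0 * y3) * (+ 1) +
      ((x1 * y0) * (+ 0) + ((x1 * y1) * (+ 0) + ((x1 * y2) * (a4) + ((x1 * y3) * (+ 0) +
      ((x2 * y0) * (+ 0) + ((x2 * y1) * (a4) + ((x2 * y2) * (a3) + ((x2 * y3) * (+ 0) +
      ((x3 * y0) * (+ 1) + ((x3 * y1) * (+ 0) + ((x3 * y2) * (+ 0) + ((x3 * y3) * (- a1) + (+ 0)))))))))))))))))
    ⟩
      ≡⟨ Q4-cong (ℤ-solve vs) (ℤ-solve vs) (ℤ-solve vs) (ℤ-solve vs) ⟩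
    mul (bqf a4 a3 a2 a1 a0) ⟨ x0 , x1 , x2 , x3 ⟩ ⟨ y0 , y1 , y2 , y3 ⟩ ∎
    where
    open ≡-Reasoning
    vs : List ℤ
    vs = a4 ∷ a3 ∷ a2 ∷ a1 ∷ a0 ∷ x0 ∷ x1 ∷ x2 ∷ x3 ∷ y0 ∷ y1 ∷ y2 ∷ y3 ∷ []

  mul-comm : ∀ F → Commutative (mul F)
  mul-comm (bqf a4 a3 a2 a1 a0) ⟨ x0 , x1 , x2 , x3 ⟩ ⟨ y0 , y1 , y2 , y3 ⟩ =
    Q4-cong (ℤ-solve vs) (ℤ-solve vs) (ℤ-solve vs) (ℤ-solve vs)
    where
    vs : List ℤ
    vs = a4 ∷ a3 ∷ a2 ∷ a1 ∷ a0 ∷ x0 ∷ x1 ∷ x2 ∷ x3 ∷ y0 ∷ y1 ∷ y2 ∷ y3 ∷ []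

  mul-assoc : ∀ F → Associative (mul F)
  mul-assoc F@(bqf a4 a3 a2 a1 a0) x@(⟨ x0 , x1 , x2 , x3 ⟩) y@(⟨ y0 , y1 , y2 , y3 ⟩) z@(⟨ z0 , z1 , z2 , z3 ⟩) = begin
    mul F (mul F x y) z ≡⟨⟩
    mul F
      ⟨ x0 * y0 - a0 * a4 * (x1 * y3 + x3 * y1 + x2 * y2) - a0 * a3 * (x2 * y3 + x3 * y2) - a0 * a2 * (x3 * y3)
      , x0 * y1 + x1 * y0 - a3 * (x1 * y1) - a2 * (x1 * y2 + x2 * y1) - a1 * (x1 * y3 + x3 * y1 + x2 * y2) - a0 * (x2 * y3 + x3 * y2)
      , x0 * y2 + x2 * y0 + a4 * (x1 * y1) - a2 * (x2 * y2) - a1 * (x2 * y3 + x3 * y2) - a0 * (x3 * y3)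
      , x0 * y3 + x3 * y0 + a4 * (x1 * y2 + x2 * y1) + a3 * (x2 * y2) - a1 * (x3 * y3)
      ⟩
      z
      ≡⟨ Q4-cong (ℤ-solve vs) (ℤ-solve vs) (ℤ-solve vs) (ℤ-solve vs) ⟩
    mul F x
      ⟨ y0 * z0 - a0 * a4 * (y1 * z3 + y3 * z1 + y2 * z2) - a0 * a3 * (y2 * z3 + y3 * z2) - a0 * a2 * (y3 * z3)
      , y0 * z1 + y1 * z0 - a3 * (y1 * z1) - a2 * (y1 * z2 + y2 * z1) - a1 * (y1 * z3 + y3 * z1 + y2 * z2) - a0 * (y2 * z3 + y3 * z2)
      , y0 * z2 + y2 * z0 + a4 * (y1 * z1) - a2 * (y2 * z2) - a1 * (y2 * z3 + y3 * z2) - a0 * (y3 * z3)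
      , y0 * z3 + y3 * z0 + a4 * (y1 * z2 + y2 * z1) + a3 * (y2 * z2) - a1 * (y3 * z3)
      ⟩
      ≡⟨⟩
    mul F x (mul F y z) ∎
    where
    open ≡-Reasoning
    vs : List ℤ
    vs = a4 ∷ a3 ∷ a2 ∷ a1 ∷ a0 ∷ x0 ∷ x1 ∷ x2 ∷ x3 ∷ y0 ∷ y1 ∷ y2 ∷ y3 ∷ z0 ∷ z1 ∷ z2 ∷ z3 ∷ []

  mul-identityˡ : ∀ F → LeftIdentity oneQ (mul F)
  mul-identityˡ F@(bqf a4 a3 a2 a1 a0) x@(⟨ x0 , x1 , x2 , x3 ⟩) = begin
    mul F oneQ x                          ≡⟨⟩
    mul F ⟨ + 1 , + 0 , + 0 , + 0 ⟩ x     ≡⟨ Q4-cong (ℤ-solve vs) (ℤ-solve vs) (ℤ-solve vs) (ℤ-solve vs) ⟩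
    x                                     ∎
    where
    open ≡-Reasoning
    vs : List ℤ
    vs = a4 ∷ a3 ∷ a2 ∷ a1 ∷ a0 ∷ x0 ∷ x1 ∷ x2 ∷ x3 ∷ []

  mul-distribˡ : ∀ F → (mul F) DistributesOverˡ _⊕_
  mul-distribˡ F@(bqf a4 a3 a2 a1 a0) x@(⟨ x0 , x1 , x2 , x3 ⟩) y@(⟨ y0 , y1 , y2 , y3 ⟩) z@(⟨ z0 , z1 , z2 , z3 ⟩) = begin
    mul F x (y ⊕ z)                                                ≡⟨⟩
    mul F x ⟨ y0 + z0 , y1 + z1 , y2 + z2 , y3 + z3 ⟩
      ≡⟨ Q4-cong (ℤ-solve vs) (ℤ-solve vs) (ℤ-solve vs) (ℤ-solve vs) ⟩
    ⟨ x0 * y0 - a0 * a4 * (x1 * y3 + x3 * y1 + x2 * y2) - a0 * a3 * (x2 * y3 + x3 * y2) - a0 * a2 * (x3 * y3)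
    , x0 * y1 + x1 * y0 - a3 * (x1 * y1) - a2 * (x1 * y2 + x2 * y1) - a1 * (x1 * y3 + x3 * y1 + x2 * y2) - a0 * (x2 * y3 + x3 * y2)
    , x0 * y2 + x2 * y0 + a4 * (x1 * y1) - a2 * (x2 * y2) - a1 * (x2 * y3 + x3 * y2) - a0 * (x3 * y3)
    , x0 * y3 + x3 * y0 + a4 * (x1 * y2 + x2 * y1) + a3 * (x2 * y2) - a1 * (x3 * y3)
    ⟩
    ⊕
    ⟨ x0 * z0 - a0 * a4 * (x1 * z3 + x3 * z1 + x2 * z2) - a0 * a3 * (x2 * z3 + x3 * z2) - a0 * a2 * (x3 * z3)
    , x0 * z1 + x1 * z0 - a3 * (x1 * z1) - a2 * (x1 * z2 + x2 * z1) - a1 * (x1 * z3 + x3 * z1 + x2 * z2) - a0 * (x2 * z3 + x3 * z2)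
    , x0 * z2 + x2 * z0 + a4 * (x1 * z1) - a2 * (x2 * z2) - a1 * (x2 * z3 + x3 * z2) - a0 * (x3 * z3)
    , x0 * z3 + x3 * z0 + a4 * (x1 * z2 + x2 * z1) + a3 * (x2 * z2) - a1 * (x3 * z3)
    ⟩
      ≡⟨⟩
    mul F x y ⊕ mul F x z ∎
    where
    open ≡-Reasoning
    vs : List ℤ
    vs = a4 ∷ a3 ∷ a2 ∷ a1 ∷ a0 ∷ x0 ∷ x1 ∷ x2 ∷ x3 ∷ y0 ∷ y1 ∷ y2 ∷ y3 ∷ z0 ∷ z1 ∷ z2 ∷ z3 ∷ []

  mul-embed : ∀ F a b → mul F (embed a) (embed b) ≡ embed (a * b)
  mul-embed F@(bqf a4 a3 a2 a1 a0) a b = begin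
    mul F (embed a) (embed b)                              ≡⟨⟩
    mul F ⟨ a , + 0 , + 0 , + 0 ⟩ ⟨ b , + 0 , + 0 , + 0 ⟩  ≡⟨ Q4-cong (ℤ-solve vs) (ℤ-solve vs) (ℤ-solve vs) (ℤ-solve vs) ⟩
    embed (a * b)                                          ∎
    where
    open ≡-Reasoning
    vs : List ℤ
    vs = a4 ∷ a3 ∷ a2 ∷ a1 ∷ a0 ∷ a ∷ b ∷ []

  ⊙-as-mul : ∀ F k x → k ⊙ x ≡ mul F (embed k) x
  ⊙-as-mul F@(bqf a4 a3 a2 a1 a0) k x@(⟨ x0 , x1 , x2 , x3 ⟩) = begin
    k ⊙ x                            ≡⟨ Q4-cong (ℤ-solve vs) (ℤ-solve vs) (ℤ-solve vs) (ℤ-solve vs) ⟩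
    mul F ⟨ k , + 0 , + 0 , + 0 ⟩ x  ≡⟨⟩
    mul F (embed k) x                ∎
    where
    open ≡-Reasoning
    vs : List ℤ
    vs = a4 ∷ a3 ∷ a2 ∷ a1 ∷ a0 ∷ k ∷ x0 ∷ x1 ∷ x2 ∷ x3 ∷ []

Q-isCommutativeRing : ∀ F → IsCommutativeRing _⊕_ (mul F) neg zeroQ oneQ
Q-isCommutativeRing F = record
  { isRing = record
    { +-isAbelianGroup = record
      { isGroup = record
        { isMonoid = record
          { isSemigroup = record
            { isMagma = record { isEquivalence = isEquivalence ; ∙-cong = cong₂ _⊕_ }
            ; assoc = ⊕-assoc
            }
          ; identity = comm∧idˡ⇒id ⊕-comm ⊕-identityˡ
          }
        ; inverse = comm∧invˡ⇒inv ⊕-comm neg-inverseˡ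
        ; ⁻¹-cong = cong neg
        }
      ; comm = ⊕-comm
      }
    ; *-cong = cong₂ (mul F)
    ; *-assoc = mul-assoc F
    ; *-identity = comm∧idˡ⇒id (mul-comm F) (mul-identityˡ F)
    ; distrib = mul-distribˡ F , comm∧distrˡ⇒distrʳ (mul-comm F) (mul-distribˡ F)
    }
  ; *-comm = mul-comm F
  }

Q-commutativeRing : BQF → CommutativeRing 0ℓ 0ℓ
Q-commutativeRing F = record { isCommutativeRing = Q-isCommutativeRing F }

module _ {c ℓ} (R : CommutativeSemiring c ℓ) where
  open CommutativeSemiring R using (_≈_; setoid; +-congˡ; *-congʳ)
    renaming (_+_ to _+ᴿ_; _*_ to _*ᴿ_; refl to ≈-refl)
  open import Algebra.Solver.Ring.NaturalCoefficients.Default R using (solve; _:=_; _:+_; _:*_)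
  open import Relation.Binary.Reasoning.Setoid setoid

  -- If b / n is a root of X² − tX − q, then products of elements of
  -- nR + bR lie in n (nR + bR).
  integral-fraction-product : ∀ {n b t q} → b *ᴿ b ≈ n *ᴿ t *ᴿ b +ᴿ n *ᴿ n *ᴿ q → ∀ u v u′ v′ →
    (n *ᴿ u +ᴿ b *ᴿ v) *ᴿ (n *ᴿ u′ +ᴿ b *ᴿ v′)
      ≈ n *ᴿ (n *ᴿ (u *ᴿ u′ +ᴿ q *ᴿ (v *ᴿ v′)) +ᴿ b *ᴿ (u *ᴿ v′ +ᴿ v *ᴿ u′ +ᴿ t *ᴿ (v *ᴿ v′)))
  integral-fraction-product {n} {b} {t} {q} b² u v u′ v′ = begin
    (n *ᴿ u +ᴿ b *ᴿ v) *ᴿ (n *ᴿ u′ +ᴿ b *ᴿ v′)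
      ≈⟨ solve 6 (λ n b u v u′ v′ →
           (n :* u :+ b :* v) :* (n :* u′ :+ b :* v′)
           := n :* (n :* (u :* u′) :+ b :* (u :* v′ :+ v :* u′)) :+ (b :* b) :* (v :* v′))
           ≈-refl n b u v u′ v′ ⟩
    n *ᴿ (n *ᴿ (u *ᴿ u′) +ᴿ b *ᴿ (u *ᴿ v′ +ᴿ v *ᴿ u′)) +ᴿ (b *ᴿ b) *ᴿ (v *ᴿ v′)
      ≈⟨ +-congˡ (*-congʳ b²) ⟩
    n *ᴿ (n *ᴿ (u *ᴿ u′) +ᴿ b *ᴿ (u *ᴿ v′ +ᴿ v *ᴿ u′)) +ᴿ (n *ᴿ t *ᴿ b +ᴿ n *ᴿ n *ᴿ q) *ᴿ (v *ᴿ v′)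
      ≈⟨ solve 8 (λ n b t q u v u′ v′ →
           n :* (n :* (u :* u′) :+ b :* (u :* v′ :+ v :* u′)) :+ (n :* t :* b :+ n :* n :* q) :* (v :* v′)
           := n :* (n :* (u :* u′ :+ q :* (v :* v′)) :+ b :* (u :* v′ :+ v :* u′ :+ t :* (v :* v′))))
           ≈-refl n b t q u v u′ v′ ⟩
    n *ᴿ (n *ᴿ (u *ᴿ u′ +ᴿ q *ᴿ (v *ᴿ v′)) +ᴿ b *ᴿ (u *ᴿ v′ +ᴿ v *ᴿ u′ +ᴿ t *ᴿ (v *ᴿ v′))) ∎

-- Q_F + (β / n) Q_F, represented as (n Q_F + β Q_F) / n.
overorder : (F : BQF) (n : ℕ) → 1 ℕ.≤ n → (β : Q4) (t q : ℤ) →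
  mul F β β ≡ (+ n * t) ⊙ β ⊕ embed (+ n * + n * q) →
  ¬ Σ Q4 (λ y → β ≡ (+ n) ⊙ y) → ProperOverring F
overorder F n 1≤n β t q β² β∉nQ = record
  { d      = n
  ; d≥1    = 1≤n
  ; P      = P
  ; P-Q    = λ x → x , zeroQ ,
               trans (⊙-as-mul F (+ n) x) (solve 3 (λ ν β x → ν :* x := ν :* x :+ β :* con 0) refl ν β x)
  ; P-add  = λ { (u , v , refl) (u′ , v′ , refl) → u ⊕ u′ , v ⊕ v′ ,
                 solve 6 (λ ν β u v u′ v′ → (ν :* u :+ β :* v) :+ (ν :* u′ :+ β :* v′) := ν :* (u :+ u′) :+ β :* (v :+ v′))
                   refl ν β u v u′ v′ }
  ; P-neg  = P-neg
  ; P-mul  = P-mul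
  ; strict = β , (zeroQ , oneQ , solve 2 (λ ν β → β := ν :* con 0 :+ β :* con 1) refl ν β) , β∉nQ
  }
  where
  module R = CommutativeRing (Q-commutativeRing F)
  open RingProperties R.ring using (-‿+-comm; -‿distribʳ-*)
  open import Algebra.Solver.Ring.NaturalCoefficients.Default R.commutativeSemiring using (solve; _:=_; _:+_; _:*_; con)
  open ≡-Reasoning

  ν : Q4
  ν = embed (+ n)

  β²-in-Q : mul F β β ≡ mul F (mul F ν (embed t)) β ⊕ mul F (mul F ν ν) (embed q)
  β²-in-Q = begin
    mul F β β                                                     ≡⟨ β² ⟩
    (+ n * t) ⊙ β ⊕ embed (+ n * + n * q)                         ≡⟨ cong₂ _⊕_ (⊙-as-mul F (+ n * t) β) (sym (mul-embed F (+ n * + n) q)) ⟩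
    mul F (embed (+ n * t)) β ⊕ mul F (embed (+ n * + n)) (embed q) ≡⟨ cong₂ (λ a b → mul F a β ⊕ mul F b (embed q)) (mul-embed F (+ n) t) (mul-embed F (+ n) (+ n)) ⟨
    mul F (mul F ν (embed t)) β ⊕ mul F (mul F ν ν) (embed q)     ∎

  P : Q4 → Set
  P x = Σ Q4 λ u → Σ Q4 λ v → x ≡ mul F ν u ⊕ mul F β v

  P-neg : ∀ {x} → P x → P (neg x)
  P-neg (u , v , refl) = neg u , neg v , (begin
    neg (mul F ν u ⊕ mul F β v)        ≡⟨ -‿+-comm (mul F ν u) (mul F β v) ⟨
    neg (mul F ν u) ⊕ neg (mul F β v)  ≡⟨ cong₂ _⊕_ (-‿distribʳ-* ν u) (-‿distribʳ-* β v) ⟩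
    mul F ν (neg u) ⊕ mul F β (neg v)  ∎)

  P-mul : ∀ {x y} → P x → P y → Σ Q4 (λ z → (mulQ F x y ≡ (+ n) ⊙ z) × P z)
  P-mul (u , v , refl) (u′ , v′ , refl) = mul F ν w₁ ⊕ mul F β w₂ , product , w₁ , w₂ , refl
    where
    w₁ w₂ : Q4
    w₁ = mul F u u′ ⊕ mul F (embed q) (mul F v v′)
    w₂ = mul F u v′ ⊕ mul F v u′ ⊕ mul F (embed t) (mul F v v′)
    product : mulQ F (mul F ν u ⊕ mul F β v) (mul F ν u′ ⊕ mul F β v′) ≡ (+ n) ⊙ (mul F ν w₁ ⊕ mul F β w₂)
    product = begin
      mulQ F (mul F ν u ⊕ mul F β v) (mul F ν u′ ⊕ mul F β v′)
        ≡⟨ mulQ≡mul F (mul F ν u ⊕ mul F β v) (mul F ν u′ ⊕ mul F β v′) ⟩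
      mul F (mul F ν u ⊕ mul F β v) (mul F ν u′ ⊕ mul F β v′)
        ≡⟨ integral-fraction-product R.commutativeSemiring {ν} {β} {embed t} {embed q} β²-in-Q u v u′ v′ ⟩
      mul F ν (mul F ν w₁ ⊕ mul F β w₂)
        ≡⟨ ⊙-as-mul F (+ n) (mul F ν w₁ ⊕ mul F β w₂) ⟨
      (+ n) ⊙ (mul F ν w₁ ⊕ mul F β w₂) ∎

-- (s + cω) / n, for a root ω of X² + BX + N, is integral over ℤ but does
-- not lie in ℤ[ω].
record IntegralFraction (B N : ℤ) : Set where
  field
    n       : ℕ
    s c     : ℤ
    1≤n     : 1 ℕ.≤ n
    n∣trace : + n ∣ + 2 * s - c * B
    n²∣norm : + n * + n ∣ s * s - c * B * s + c * c * N
    n∤c     : ¬ (+ n ∣ c)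

residue : ∀ m d .{{_ : ℕ.NonZero d}} → Σ (Fin d) λ r → Σ ℤ λ k → m ≡ + toℕ r + + d * k
residue m d = fromℕ< (n%ℕd<d m d) , m /ℕ d , (begin
  m                            ≡⟨ a≡a%ℕn+[a/ℕn]*n m d ⟩
  + (m %ℕ d) + (m /ℕ d) * + d  ≡⟨ cong₂ _+_ (cong +_ (sym (toℕ-fromℕ< (n%ℕd<d m d)))) (*-comm (m /ℕ d) (+ d)) ⟩
  + toℕ (fromℕ< (n%ℕd<d m d)) + + d * (m /ℕ d) ∎)
  where open ≡-Reasoning

even-or-odd : ∀ m → Σ ℤ (λ k → m ≡ + 2 * k) ⊎ Σ ℤ (λ k → m ≡ + 1 + + 2 * k)
even-or-odd m with residue m 2
... | zero     , k , m≡ = inj₁ (k , trans m≡ (+-identityˡ (+ 2 * k)))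
... | suc zero , k , m≡ = inj₂ (k , m≡)

squarefree? : ∀ a → (∀ n → n ℕ.* n ℕ.∣ a → n ≡ 1) ⊎ Σ ℕ λ n → 1 ℕ.< n × n ℕ.* n ℕ.∣ a
squarefree? 0 = inj₂ (2 , s≤s (s≤s z≤n) , (2 ℕ.* 2) ℕ.∣0)
squarefree? a@(suc _) with ℕ.anyUpTo? (λ n → 1 ℕ.<? n ×-dec n ℕ.* n ℕ.∣? a) (suc a)
... | yes (n , _ , 1<n , n²∣a) = inj₂ (n , 1<n , n²∣a)
... | no ∄ = inj₁ λ where
  0 0∣a → contradiction (ℕ.0∣⇒≡0 0∣a) λ ()
  1 _ → refl
  n@(suc (suc _)) n²∣a → contradiction (n , s≤s (ℕ.≤-trans (ℕ.m≤m*n n n) (ℕ.∣⇒≤ n²∣a)) , s≤s (s≤s z≤n) , n²∣a) ∄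

squarefree-or-square-factor : ∀ m → SquarefreeZ m ⊎ Σ ℕ λ n → 1 ℕ.< n × + n * + n ∣ m
squarefree-or-square-factor m with squarefree? ∣ m ∣
... | inj₁ squarefree        = inj₁ squarefree
... | inj₂ (n , 1<n , n²∣m) = inj₂ (n , 1<n , ∣ᵤ⇒∣ (subst (ℕ._∣ ∣ m ∣) (sym (abs-* (+ n) (+ n))) n²∣m))

smaller-∤ : ∀ {n c} → suc c ℕ.< n → ¬ (+ n ∣ + suc c)
smaller-∤ c<n n∣c = ℕ.>⇒∤ c<n (∣⇒∣ᵤ n∣c)

even-square-factor : ∀ {b N n} → 1 ℕ.< n → + n * + n ∣ b * b - N → IntegralFraction (+ 2 * b) N
even-square-factor {b} {N} {n} 1<n n²∣m = record
  { n = n ; s = b ; c = + 1 ; 1≤n = ℕ.<⇒≤ 1<n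
  ; n∣trace = divides (+ 0) trace≡0
  ; n²∣norm = subst (_ ∣_) norm≡-m (∣m⇒∣-m n²∣m)
  ; n∤c = smaller-∤ 1<n
  }
  where
  trace≡0 : + 2 * b - + 1 * (+ 2 * b) ≡ + 0
  trace≡0 = ℤ-solve (b ∷ [])
  norm≡-m : - (b * b - N) ≡ b * b - + 1 * (+ 2 * b) * b + + 1 * + 1 * N
  norm≡-m = ℤ-solve (b ∷ N ∷ [])

even-one-mod-four : ∀ {b N k} → b * b - N ≡ + 1 + + 4 * k → IntegralFraction (+ 2 * b) N
even-one-mod-four {b} {N} {k} m≡ = record
  { n = 2 ; s = b + + 1 ; c = + 1 ; 1≤n = s≤s z≤n
  ; n∣trace = divides (+ 1) (ℤ-solve (b ∷ []))
  ; n²∣norm = divides (- k) (begin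
      (b + + 1) * (b + + 1) - + 1 * (+ 2 * b) * (b + + 1) + + 1 * + 1 * N  ≡⟨ ℤ-solve (b ∷ N ∷ []) ⟩
      + 1 - (b * b - N)                                                     ≡⟨ cong (λ m → + 1 - m) m≡ ⟩
      + 1 - (+ 1 + + 4 * k)                                                 ≡⟨ ℤ-solve (k ∷ []) ⟩
      - k * (+ 2 * + 2)                                                     ∎)
  ; n∤c = smaller-∤ (s≤s (s≤s z≤n))
  }
  where open ≡-Reasoning

discriminant-square-factor : ∀ {B N n} → 2 ℕ.< n → + n * + n ∣ B * B - + 4 * N → IntegralFraction B N
discriminant-square-factor {B} {N} {n} 2<n n²∣D = record
  { n = n ; s = B ; c = + 2 ; 1≤n = ℕ.≤-trans (s≤s z≤n) (ℕ.<⇒≤ 2<n)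
  ; n∣trace = divides (+ 0) trace≡0
  ; n²∣norm = subst (_ ∣_) norm≡-D (∣m⇒∣-m n²∣D)
  ; n∤c = smaller-∤ 2<n
  }
  where
  trace≡0 : + 2 * B - + 2 * B ≡ + 0
  trace≡0 = ℤ-solve (B ∷ [])
  norm≡-D : - (B * B - + 4 * N) ≡ B * B - + 2 * B * B + + 2 * + 2 * N
  norm≡-D = ℤ-solve (B ∷ N ∷ [])

even-discriminant : ∀ b N → FundamentalDisc (+ 2 * b * (+ 2 * b) - + 4 * N) ⊎ IntegralFraction (+ 2 * b) N
even-discriminant b N = by-residue (residue (b * b - N) 4)
  where
  D≡4m : + 2 * b * (+ 2 * b) - + 4 * N ≡ + 4 * (b * b - N)
  D≡4m = ℤ-solve (b ∷ N ∷ [])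

  unless-square-factor : (SquarefreeZ (b * b - N) → FundamentalDisc (+ 2 * b * (+ 2 * b) - + 4 * N)) →
    FundamentalDisc (+ 2 * b * (+ 2 * b) - + 4 * N) ⊎ IntegralFraction (+ 2 * b) N
  unless-square-factor fundamental with squarefree-or-square-factor (b * b - N)
  ... | inj₁ squarefree        = inj₁ (fundamental squarefree)
  ... | inj₂ (n , 1<n , n²∣m) = inj₂ (even-square-factor 1<n n²∣m)

  by-residue : Σ (Fin 4) (λ r → Σ ℤ λ k → b * b - N ≡ + toℕ r + + 4 * k) →
    FundamentalDisc (+ 2 * b * (+ 2 * b) - + 4 * N) ⊎ IntegralFraction (+ 2 * b) N
  by-residue (zero , k , m≡) =
    inj₂ (even-square-factor {n = 2} (s≤s (s≤s z≤n)) (divides k (trans m≡ (ℤ-solve (k ∷ [])))))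
  by-residue (suc zero , k , m≡) = inj₂ (even-one-mod-four {k = k} m≡)
  by-residue (suc (suc zero) , k , m≡) =
    unless-square-factor λ squarefree → inj₂ (b * b - N , D≡4m , inj₁ (k , m≡) , squarefree)
  by-residue (suc (suc (suc zero)) , k , m≡) =
    unless-square-factor λ squarefree → inj₂ (b * b - N , D≡4m , inj₂ (k , m≡) , squarefree)

odd-discriminant : ∀ b N →
  FundamentalDisc ((+ 1 + + 2 * b) * (+ 1 + + 2 * b) - + 4 * N) ⊎ IntegralFraction (+ 1 + + 2 * b) N
odd-discriminant b N = by-square-factor (squarefree-or-square-factor D)
  where
  D : ℤ
  D = (+ 1 + + 2 * b) * (+ 1 + + 2 * b) - + 4 * N

  D≡1+4k : (+ 1 + + 2 * b) * (+ 1 + + 2 * b) - + 4 * N ≡ + 1 + + 4 * (b * b + b - N)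
  D≡1+4k = ℤ-solve (b ∷ N ∷ [])

  4∤D : ¬ (+ 2 * + 2 ∣ D)
  4∤D 4∣D = smaller-∤ {n = 4} {c = 0} (s≤s (s≤s z≤n))
    (∣m+n∣n⇒∣m (subst (_ ∣_) D≡1+4k 4∣D) (divides (b * b + b - N) (*-comm (+ 4) (b * b + b - N))))

  by-square-factor : SquarefreeZ D ⊎ Σ ℕ (λ n → 1 ℕ.< n × + n * + n ∣ D) →
    FundamentalDisc D ⊎ IntegralFraction (+ 1 + + 2 * b) N
  by-square-factor (inj₁ squarefree)            = inj₁ (inj₁ ((b * b + b - N , D≡1+4k) , squarefree))
  by-square-factor (inj₂ (0 , () , _))
  by-square-factor (inj₂ (1 , s≤s () , _))
  by-square-factor (inj₂ (2 , _ , 4∣D))         = ⊥-elim (4∤D 4∣D)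
  by-square-factor (inj₂ (suc (suc (suc _)) , _ , n²∣D)) =
    inj₂ (discriminant-square-factor (s≤s (s≤s (s≤s z≤n))) n²∣D)

fundamental-or-integral-fraction : ∀ B N → FundamentalDisc (B * B - + 4 * N) ⊎ IntegralFraction B N
fundamental-or-integral-fraction B N with even-or-odd B
... | inj₁ (b , refl) = even-discriminant b N
... | inj₂ (b , refl) = odd-discriminant b N

-- β c s plays the role of s + cω for a root ω ∈ Q_F of X² + BX + N that
-- can be completed to a ℤ-basis of Q_F containing 1.
record QuadraticSuborder (F : BQF) (B N : ℤ) : Set where
  field
    β           : ℤ → ℤ → Q4
    β-square    : ∀ c s → mul F (β c s) (β c s) ≡ (+ 2 * s - c * B) ⊙ β c s ⊕ embed (c * B * s - s * s - c * c * N)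
    β-primitive : ∀ c s n y → β c s ≡ (+ n) ⊙ y → + n ∣ c

proper-overring : ∀ {F B N} → QuadraticSuborder F B N → IntegralFraction B N → ProperOverring F
proper-overring {F} {B} {N} O
  record { n = n ; s = s ; c = c ; 1≤n = 1≤n ; n∣trace = divides t trace≡ ; n²∣norm = divides q norm≡ ; n∤c = n∤c } =
  overorder F n 1≤n (β c s) t (- q) β² λ (y , β≡ny) → n∤c (β-primitive c s n y β≡ny)
  where
  open QuadraticSuborder O
  open ≡-Reasoning
  constant≡ : c * B * s - s * s - c * c * N ≡ + n * + n * - q
  constant≡ = begin
    c * B * s - s * s - c * c * N      ≡⟨ ℤ-solve (c ∷ B ∷ s ∷ N ∷ []) ⟩
    - (s * s - c * B * s + c * c * N)  ≡⟨ cong -_ (trans norm≡ (*-comm q (+ n * + n))) ⟩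
    - (+ n * + n * q)                  ≡⟨ neg-distribʳ-* (+ n * + n) q ⟩
    + n * + n * - q                    ∎

  β² : mul F (β c s) (β c s) ≡ (+ n * t) ⊙ β c s ⊕ embed (+ n * + n * - q)
  β² = begin
    mul F (β c s) (β c s)                                              ≡⟨ β-square c s ⟩
    (+ 2 * s - c * B) ⊙ β c s ⊕ embed (c * B * s - s * s - c * c * N)
      ≡⟨ cong₂ (λ a b → a ⊙ β c s ⊕ embed b) (trans trace≡ (*-comm t (+ n))) constant≡ ⟩
    (+ n * t) ⊙ β c s ⊕ embed (+ n * + n * - q)                         ∎

maximal⇒fundamental : ∀ {F B N} → QuadraticSuborder F B N → Maximal F → FundamentalDisc (B * B - + 4 * N)
maximal⇒fundamental {B = B} {N} O maximal =
  [ id , (λ fraction → ⊥-elim (maximal (proper-overring O fraction))) ]′ (fundamental-or-integral-fraction B N)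

coord-⊙ : ∀ k x i → coord (k ⊙ x) i ≡ k * coord x i
coord-⊙ k x zero                   = refl
coord-⊙ k x (suc zero)             = refl
coord-⊙ k x (suc (suc zero))       = refl
coord-⊙ k x (suc (suc (suc zero))) = refl

divides-coordinate : ∀ {x} n y i → x ≡ (+ n) ⊙ y → + n ∣ coord x i
divides-coordinate n y i refl = divides (coord y i) (trans (coord-⊙ (+ n) y i) (*-comm (+ n) (coord y i)))

β₁ : ℤ → ℤ → Q4
β₁ c s = ⟨ s , + 0 , c , + 0 ⟩

β₂ β₃ : ℤ → ℤ → ℤ → Q4
β₂ B c s = ⟨ s - c * B , c , + 0 , - c ⟩
β₃ B c s = ⟨ s - c * B , c , + 0 , c ⟩

opaque
  unfolding mul

  form₁-suborder : ∀ A B C → QuadraticSuborder (form₁ A B C) B (A * C)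
  form₁-suborder A B C = record { β = β₁ ; β-square = square ; β-primitive = λ c s n y → divides-coordinate n y (suc (suc zero)) }
    where
    square : ∀ c s → mul (form₁ A B C) (β₁ c s) (β₁ c s) ≡ (+ 2 * s - c * B) ⊙ β₁ c s ⊕ embed (c * B * s - s * s - c * c * (A * C))
    square c s = begin
      mul (form₁ A B C) (β₁ c s) (β₁ c s)  ≡⟨⟩
      mul (bqf A (+ 0) B (+ 0) C) ⟨ s , + 0 , c , + 0 ⟩ ⟨ s , + 0 , c , + 0 ⟩
        ≡⟨ Q4-cong (ℤ-solve vs) (ℤ-solve vs) (ℤ-solve vs) (ℤ-solve vs) ⟩
      ⟨ (+ 2 * s - c * B) * s + (c * B * s - s * s - c * c * (A * C))
        , (+ 2 * s - c * B) * + 0 + + 0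
        , (+ 2 * s - c * B) * c + + 0
        , (+ 2 * s - c * B) * + 0 + + 0
        ⟩  ≡⟨⟩
      (+ 2 * s - c * B) ⊙ β₁ c s ⊕ embed (c * B * s - s * s - c * c * (A * C))  ∎
      where
      open ≡-Reasoning
      vs : List ℤ
      vs = A ∷ B ∷ C ∷ c ∷ s ∷ []

  form₂-suborder : ∀ A B C → QuadraticSuborder (form₂ A B C) B (A * C)
  form₂-suborder A B C = record { β = β₂ B ; β-square = square ; β-primitive = λ c s n y → divides-coordinate n y (suc zero) }
    where
    square : ∀ c s → mul (form₂ A B C) (β₂ B c s) (β₂ B c s) ≡ (+ 2 * s - c * B) ⊙ β₂ B c s ⊕ embed (c * B * s - s * s - c * c * (A * C))
    square c s = begin
      mul (form₂ A B C) (β₂ B c s) (β₂ B c s)  ≡⟨⟩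
      mul (bqf A B (C + + 2 * A) B A) ⟨ s - c * B , c , + 0 , - c ⟩ ⟨ s - c * B , c , + 0 , - c ⟩
        ≡⟨ Q4-cong (ℤ-solve vs) (ℤ-solve vs) (ℤ-solve vs) (ℤ-solve vs) ⟩
      ⟨ (+ 2 * s - c * B) * (s - c * B) + (c * B * s - s * s - c * c * (A * C))
        , (+ 2 * s - c * B) * c + + 0
        , (+ 2 * s - c * B) * + 0 + + 0
        , (+ 2 * s - c * B) * - c + + 0
        ⟩  ≡⟨⟩
      (+ 2 * s - c * B) ⊙ β₂ B c s ⊕ embed (c * B * s - s * s - c * c * (A * C))  ∎
      where
      open ≡-Reasoning
      vs : List ℤ
      vs = A ∷ B ∷ C ∷ c ∷ s ∷ []

  form₃-suborder : ∀ A B C → QuadraticSuborder (form₃ A B C) B (A * C)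
  form₃-suborder A B C = record { β = β₃ B ; β-square = square ; β-primitive = λ c s n y → divides-coordinate n y (suc zero) }
    where
    square : ∀ c s → mul (form₃ A B C) (β₃ B c s) (β₃ B c s) ≡ (+ 2 * s - c * B) ⊙ β₃ B c s ⊕ embed (c * B * s - s * s - c * c * (A * C))
    square c s = begin
      mul (form₃ A B C) (β₃ B c s) (β₃ B c s)  ≡⟨⟩
      mul (bqf A B (C - + 2 * A) (- B) A) ⟨ s - c * B , c , + 0 , c ⟩ ⟨ s - c * B , c , + 0 , c ⟩
        ≡⟨ Q4-cong (ℤ-solve vs) (ℤ-solve vs) (ℤ-solve vs) (ℤ-solve vs) ⟩
      ⟨ (+ 2 * s - c * B) * (s - c * B) + (c * B * s - s * s - c * c * (A * C))
        , (+ 2 * s - c * B) * c + + 0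
        , (+ 2 * s - c * B) * + 0 + + 0
        , (+ 2 * s - c * B) * c + + 0
        ⟩  ≡⟨⟩
      (+ 2 * s - c * B) ⊙ β₃ B c s ⊕ embed (c * B * s - s * s - c * c * (A * C))  ∎
      where
      open ≡-Reasoning
      vs : List ℤ
      vs = A ∷ B ∷ C ∷ c ∷ s ∷ []

corollary4p4 : (A B C : ℤ) (F : BQF) →
    (F ≡ form₁ A B C ⊎ F ≡ form₂ A B C ⊎ F ≡ form₃ A B C) →
    Maximal F → FundamentalDisc (B * B - + 4 * A * C)
corollary4p4 A B C F form maximal =
  subst (λ N → FundamentalDisc (B * B - N)) (sym (*-assoc (+ 4) A C)) (maximal⇒fundamental (suborder form) maximal)
  where
  suborder : F ≡ form₁ A B C ⊎ F ≡ form₂ A B C ⊎ F ≡ form₃ A B C → QuadraticSuborder F B (A * C)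
  suborder (inj₁ refl)        = form₁-suborder A B C
  suborder (inj₂ (inj₁ refl)) = form₂-suborder A B C
  suborder (inj₂ (inj₂ refl)) = form₃-suborder A B C
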